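{- Let $d \geq 2$ and $n,k \geq 0$ be integers. Then the number of $d$-ary operator monomials $M \in \mathcal{M}_d$ with $\operatorname{topt}(M) = n$ and $\operatorname{lopt}(M) = k$ equals \[ N_d(n,k) = \frac{1}{n+1} \binom{n+1}{k+1} \binom{ n + (n-k)(d-2)+1}{k}. \]
   Context: Let $\mathcal{A}$ be an associative $d$-ary algebra: a vector space with a multilinear product $(a_1,\dots,a_d)\mapsto a_1\cdots a_d$ satisfying $d$-ary associativity, $a_1 \cdots a_i ( a_{i+1} \cdots a_{i+d} ) a_{i+d+1} \cdots a_{2d-1} = a_1 \cdots a_j ( a_{j+1} \cdots a_{j+d} ) a_{j+d+1} \cdots a_{2d-1}$ for all $0\le i<j\le d-1$, so that parentheses in iterated products may be removed unambiguously. Let $L$ be a linear operator on $\mathcal{A}$. The set $\mathcal{M}_d$ of ($d$-ary) operator monomials is defined recursively: a single indeterminate is an operator monomial; if $M_1,\dots,M_d$ are operator monomials then the product $M_1\cdots M_d$ is one; if $M$ is one then $L(M)$ is one. Monomials are regarded as formal expressions with the $d$-ary product parentheses removed (identified up to $d$-ary associativity) and with indeterminates named $a_1,a_2,\dots$ from left to right; equivalently, an operator monomial is either a single indeterminate, or $L(M')$ with $M'$ an operator monomial, or a concatenation $M_1 M_2\cdots M_\ell$ with $\ell \equiv 1 \pmod{d-1}$, $\ell\ge d$, where each $M_i$ is either a single indeterminate or of the form $L(M_i')$. For example, for $d=3$ the monomials with $3$ total operations include $a_1a_2a_3a_4a_5a_6a_7$, $L(a_1a_2a_3)a_4a_5$,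 $L(L(a_1))a_2a_3$, $L(L(L(a_1)))$. For $M\in\mathcal{M}_d$, $\operatorname{topt}(M)$ is the total number of operations in $M$ (occurrences of $L$ plus number of applications of the $d$-ary product; a monomial with $m$ indeterminates uses $(m-1)/(d-1)$ products), and $\operatorname{lopt}(M)$ is the number of occurrences of $L$. -}

module Defs where

open import Data.Nat using (ℕ; zero; suc; _+_; _*_; _∸_)
open import Data.Vec using (Vec; []; _∷_)

-- d-ary operator monomials, in the normal form of the paper
-- (parentheses of the d-ary product removed; indeterminates named
-- a₁, a₂, … from left to right, so only the shape matters):
--   an operator monomial is a concatenation  M₁ M₂ ⋯ M_ℓ  of ℓ "atoms",
--   where ℓ = 1 + m (d - 1) for some m ≥ 0 (m = number of d-ary products);
--   ℓ = 1 is a single atom.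
mutual
  data Atom (d : ℕ) : Set where
    ind : Atom d
    L   : Mono d → Atom d

  data Mono (d : ℕ) : Set where
    -- m = number of applications of the d-ary product at top level
    concat : (m : ℕ) → Vec (Atom d) (suc (m * (d ∸ 1))) → Mono d

mutual
  toptA : ∀ {d} → Atom d → ℕ
  toptA ind   = 0
  toptA (L M) = suc (topt M)

  toptV : ∀ {d n} → Vec (Atom d) n → ℕ
  toptV []       = 0
  toptV (a ∷ as) = toptA a + toptV as

  topt : ∀ {d} → Mono d → ℕ
  topt (concat m as) = m + toptV as

mutual
  loptA : ∀ {d} → Atom d → ℕ
  loptA ind   = 0
  loptA (L M) = suc (lopt M)

  loptV : ∀ {d n} → Vec (Atom d) n → ℕ
  loptV []       = 0
  loptV (a ∷ as) = loptA a + loptV as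

  lopt : ∀ {d} → Mono d → ℕ
  lopt (concat m as) = loptV as

module Submission where

-- Call a sequence of atoms (indeterminates or L(M)) a row. A row whose first atom is L(M) is the
-- monomial M followed by the rest of the row, and a monomial with m + 1 products followed by a
-- row is a monomial with m products followed by a row that is d − 1 atoms longer; a monomial
-- with no product is a single atom. This gives a linear recurrence for the numbers of rows of r
-- atoms with prescribed numbers of operations and of L's, and M ↦ L(M) identifies monomials with
-- the one-atom rows containing an L. By induction, using Pascal's rule and the absorption
-- identity k C(n, k) = n C(n − 1, k − 1), the number of rows of r atoms with P products and k + 1
-- occurrences of L is r C(r + P(d − 1) + k, k) C(P + k, k) / (k + 1). For r = 1 and n = P + k
-- this is the stated formula, since (n + 1) C(n, k) = (k + 1) C(n + 1, k + 1).

open import Defs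
open import Data.Nat using (ℕ; zero; suc; _+_; _*_; _∸_; _≤_; _<_; s≤s; z≤n; _≤?_)
open import Data.Nat.Properties
  using ( +-assoc; +-comm; +-suc; +-identityʳ; +-cancelˡ-≡; +-cancelʳ-≡
        ; *-assoc; *-zeroʳ; *-identityˡ; *-identityʳ; *-distribˡ-+; *-cancelˡ-≡
        ; suc-injective; ≡-irrelevant; <⇒≤; n<1+n; ≰⇒>; m∸n+n≡m )
open import Data.Nat.Combinatorics using (_C_; nC1≡n; nCn≡1; nCk+nC[k+1]≡[n+1]C[k+1]; k>n⇒nCk≡0)
open import Data.Nat.Tactic.RingSolver using (solve-∀)
open import Data.Vec using (Vec; []; _∷_; _++_; take; drop)
open import Data.Vec.Properties using (take++drop≡id)
open import Data.Fin using (Fin)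
open import Data.Fin.Properties using (+↔⊎; 1↔⊤)
open import Data.Product using (Σ; _×_; _,_; ∃)
open import Data.Empty using (⊥; ⊥-elim)
open import Data.Sum using (_⊎_; inj₁; inj₂)
open import Data.Sum.Function.Propositional using (_⊎-↔_)
open import Function.Bundles using (_↔_; mk↔ₛ′)
open import Function.Properties.Inverse using (↔-sym; ↔-trans)
open import Relation.Nullary using (yes; no)
open import Relation.Binary.PropositionalEquality
open ≡-Reasoning

[k+1]*[n+1]C[k+1]≡[n+1]*nCk : ∀ n k → suc k * (suc n C suc k) ≡ suc n * (n C k)
[k+1]*[n+1]C[k+1]≡[n+1]*nCk zero    zero    = refl
[k+1]*[n+1]C[k+1]≡[n+1]*nCk zero    (suc k) = *-zeroʳ (suc (suc k))
[k+1]*[n+1]C[k+1]≡[n+1]*nCk (suc n) zero    =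
  trans (*-identityˡ _) (trans (nC1≡n (suc (suc n))) (sym (*-identityʳ (suc (suc n)))))
[k+1]*[n+1]C[k+1]≡[n+1]*nCk (suc n) (suc k) = begin
  suc (suc k) * (suc (suc n) C suc (suc k))
    ≡⟨ cong (suc (suc k) *_) (sym (nCk+nC[k+1]≡[n+1]C[k+1] (suc n) (suc k))) ⟩
  suc (suc k) * (a + b)
    ≡⟨ split k a b ⟩
  a + suc k * a + suc (suc k) * b
    ≡⟨ cong₂ (λ s t → a + s + t) ([k+1]*[n+1]C[k+1]≡[n+1]*nCk n k) ([k+1]*[n+1]C[k+1]≡[n+1]*nCk n (suc k)) ⟩
  a + suc n * (n C k) + suc n * (n C suc k)
    ≡⟨ +-assoc a _ _ ⟩
  a + (suc n * (n C k) + suc n * (n C suc k))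
    ≡⟨ cong (a +_) (sym (*-distribˡ-+ (suc n) (n C k) (n C suc k))) ⟩
  a + suc n * (n C k + n C suc k)
    ≡⟨ cong (λ c → a + suc n * c) (nCk+nC[k+1]≡[n+1]C[k+1] n k) ⟩
  suc (suc n) * a ∎
  where
  a = suc n C suc k
  b = suc n C suc (suc k)
  split : ∀ k a b → suc (suc k) * (a + b) ≡ a + suc k * a + suc (suc k) * b
  split = solve-∀

[k+1]*[a+k]C[k+1]≡a*[a+k]Ck : ∀ a k → suc k * ((a + k) C suc k) ≡ a * ((a + k) C k)
[k+1]*[a+k]C[k+1]≡a*[a+k]Ck a k = +-cancelˡ-≡ (suc k * c) _ _ (begin
  suc k * c + suc k * ((a + k) C suc k)   ≡⟨ sym (*-distribˡ-+ (suc k) c _) ⟩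
  suc k * (c + (a + k) C suc k)           ≡⟨ cong (suc k *_) (nCk+nC[k+1]≡[n+1]C[k+1] (a + k) k) ⟩
  suc k * (suc (a + k) C suc k)           ≡⟨ [k+1]*[n+1]C[k+1]≡[n+1]*nCk (a + k) k ⟩
  suc (a + k) * c                         ≡⟨ split a k c ⟩
  suc k * c + a * c                       ∎)
  where
  c = (a + k) C k
  split : ∀ a k c → suc (a + k) * c ≡ suc k * c + a * c
  split = solve-∀

-- rowCount r n k and monoRowCount r n k count the rows of r atoms, respectively the monomials
-- followed by r atoms, with n operations and k occurrences of L, where e = d − 1.
module RowCounts (e : ℕ) where

  mutual
    rowCount : ℕ → ℕ → ℕ → ℕ
    rowCount zero    zero    zero    = 1
    rowCount zero    (suc n) k       = 0
    rowCount zero    zero    (suc k) = 0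
    rowCount (suc r) n       zero    = rowCount r n zero
    rowCount (suc r) zero    (suc k) = rowCount r zero (suc k)
    rowCount (suc r) (suc n) (suc k) = rowCount r (suc n) (suc k) + monoRowCount r n k

    monoRowCount : ℕ → ℕ → ℕ → ℕ
    monoRowCount r zero    k = rowCount r zero k
    monoRowCount r (suc n) k = monoRowCount (r + e) n k + rowCount (suc r) (suc n) k

  rowCount-zero-zero : ∀ r → rowCount r 0 0 ≡ 1
  rowCount-zero-zero zero    = refl
  rowCount-zero-zero (suc r) = rowCount-zero-zero r

  rowCount-suc-zero : ∀ r n → rowCount r (suc n) 0 ≡ 0
  rowCount-suc-zero zero    n = refl
  rowCount-suc-zero (suc r) n = rowCount-suc-zero r n

  mutual
    rowCount-vanishes : ∀ r {n k} → n < k → rowCount r n k ≡ 0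
    rowCount-vanishes zero    {zero}  {suc k} _         = refl
    rowCount-vanishes zero    {suc n}         _         = refl
    rowCount-vanishes (suc r) {zero}  {suc k} n<k       = rowCount-vanishes r n<k
    rowCount-vanishes (suc r) {suc n} {suc k} (s≤s n<k) =
      cong₂ _+_ (rowCount-vanishes r (s≤s n<k)) (monoRowCount-vanishes r n<k)

    monoRowCount-vanishes : ∀ r {n k} → n < k → monoRowCount r n k ≡ 0
    monoRowCount-vanishes r {zero}  n<k = rowCount-vanishes r n<k
    monoRowCount-vanishes r {suc n} n<k =
      cong₂ _+_ (monoRowCount-vanishes (r + e) (<⇒≤ n<k)) (rowCount-vanishes (suc r) n<k)

  -- Rows of r atoms with P products and k + 1 occurrences of L.
  rowCount′ : ℕ → ℕ → ℕ → ℕ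
  rowCount′ r P k = rowCount r (suc (P + k)) (suc k)

  rowCount′-recurrence : ∀ r P k →
    rowCount′ (suc r) (suc P) k + rowCount′ (r + e) P k
      ≡ rowCount′ r (suc P) k + rowCount′ (suc r + e) P k + rowCount (suc r) (suc (P + k)) k
  rowCount′-recurrence r P k = rearrange (rowCount′ r (suc P) k) (monoRowCount (r + e) (P + k) k)
                                  (rowCount (suc r) (suc (P + k)) k) (rowCount′ (r + e) P k)
    where
    rearrange : ∀ a m b c → a + (m + b) + c ≡ a + (c + m) + b
    rearrange = solve-∀

  rowCount′-single-L : ∀ P r → rowCount′ r P 0 ≡ r
  rowCount′-single-L P       zero    = refl
  rowCount′-single-L zero    (suc r) =
    trans (cong₂ _+_ (rowCount′-single-L 0 r) (rowCount-zero-zero r)) (+-comm r 1)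
  rowCount′-single-L (suc P) (suc r) = +-cancelʳ-≡ (r + e) _ _ (begin
    rowCount′ (suc r) (suc P) 0 + (r + e)
      ≡⟨ cong (rowCount′ (suc r) (suc P) 0 +_) (sym (rowCount′-single-L P (r + e))) ⟩
    rowCount′ (suc r) (suc P) 0 + rowCount′ (r + e) P 0
      ≡⟨ rowCount′-recurrence r P 0 ⟩
    rowCount′ r (suc P) 0 + rowCount′ (suc r + e) P 0 + rowCount (suc r) (suc (P + 0)) 0
      ≡⟨ cong₂ _+_ (cong₂ _+_ (rowCount′-single-L (suc P) r) (rowCount′-single-L P (suc r + e)))
                   (rowCount-suc-zero (suc r) (P + 0)) ⟩
    r + (suc r + e) + 0
      ≡⟨ rearrange r e ⟩
    suc r + (r + e) ∎)
    where
    rearrange : ∀ r e → r + (suc r + e) + 0 ≡ suc r + (r + e)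
    rearrange = solve-∀

  closedForm : ℕ → ℕ → ℕ → ℕ
  closedForm r P k = r * ((r + P * e + k) C k) * ((P + k) C k)

  closedForm-recurrence₀ : ∀ r j → suc j * closedForm (suc r) 0 (suc j)
                        ≡ suc j * closedForm r 0 (suc j) + suc (suc j) * closedForm (suc r) 0 j
  closedForm-recurrence₀ r j = +-cancelʳ-≡ (suc r * y) _ _ (begin
    suc j * closedForm (suc r) 0 (suc j) + suc r * y
      ≡⟨ cong (λ c → suc j * c + suc r * y) F₁ ⟩
    suc j * (suc r * (y + x)) + suc r * y
      ≡⟨ expand j r x y ⟩
    suc j * (r * x) + suc (suc j) * (suc r * y) + suc j * x
      ≡⟨ cong₂ (λ a b → suc j * a + suc (suc j) * b + suc j * x) (sym F₃) (sym F₅) ⟩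
    suc j * closedForm r 0 (suc j) + suc (suc j) * closedForm (suc r) 0 j + suc j * x
      ≡⟨ cong (suc j * closedForm r 0 (suc j) + suc (suc j) * closedForm (suc r) 0 j +_) absorption ⟩
    suc j * closedForm r 0 (suc j) + suc (suc j) * closedForm (suc r) 0 j + suc r * y ∎)
    where
    M = r + suc j
    x = M C suc j
    y = M C j
    r+0≡r = +-identityʳ r
    F₁ : closedForm (suc r) 0 (suc j) ≡ suc r * (y + x)
    F₁ = begin
      suc r * (suc (r + 0 + suc j) C suc j) * (suc j C suc j)
        ≡⟨ cong₂ (λ a b → suc r * (suc (a + suc j) C suc j) * b) r+0≡r (nCn≡1 (suc j)) ⟩
      suc r * (suc M C suc j) * 1
        ≡⟨ cong (λ a → suc r * a * 1) (sym (nCk+nC[k+1]≡[n+1]C[k+1] M j)) ⟩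
      suc r * (y + x) * 1
        ≡⟨ *-identityʳ _ ⟩
      suc r * (y + x) ∎
    F₃ : closedForm r 0 (suc j) ≡ r * x
    F₃ = trans (cong₂ (λ a b → r * ((a + suc j) C suc j) * b) r+0≡r (nCn≡1 (suc j))) (*-identityʳ _)
    F₅ : closedForm (suc r) 0 j ≡ suc r * y
    F₅ = trans (cong₂ (λ a b → suc r * (suc (a + j) C j) * b) r+0≡r (nCn≡1 j))
               (trans (cong (λ a → suc r * (a C j) * 1) (sym (+-suc r j))) (*-identityʳ _))
    absorption : suc j * x ≡ suc r * y
    absorption = subst (λ n → suc j * (n C suc j) ≡ suc r * (n C j)) (sym (+-suc r j))
                       ([k+1]*[a+k]C[k+1]≡a*[a+k]Ck (suc r) j)
    expand : ∀ j r x y → suc j * (suc r * (y + x)) + suc r * y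
                       ≡ suc j * (r * x) + suc (suc j) * (suc r * y) + suc j * x
    expand = solve-∀

  closedForm-recurrence : ∀ r P j →
    suc j * (closedForm (suc r) (suc P) (suc j) + closedForm (r + e) P (suc j))
      ≡ suc j * (closedForm r (suc P) (suc j) + closedForm (suc r + e) P (suc j))
        + suc (suc j) * closedForm (suc r) (suc P) j
  closedForm-recurrence r P j = begin
    suc j * (closedForm (suc r) (suc P) (suc j) + closedForm (r + e) P (suc j))
      ≡⟨ cong₂ (λ a b → suc j * (a + b)) F₁ F₂ ⟩
    suc j * (suc r * (y + x) * (v + u) + (r + e) * x * u)
      ≡⟨ +-cancelʳ-≡ T _ _ balance ⟩
    suc j * (r * x * (v + u) + (suc r + e) * (y + x) * u) + suc (suc j) * (suc r * y * v)
      ≡⟨ sym (cong₂ (λ a b → suc j * a + suc (suc j) * b) (cong₂ _+_ F₃ F₄) F₅) ⟩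
    suc j * (closedForm r (suc P) (suc j) + closedForm (suc r + e) P (suc j))
      + suc (suc j) * closedForm (suc r) (suc P) j ∎
    where
    M = r + suc P * e + suc j
    x = M C suc j
    y = M C j
    N = P + suc j
    u = N C suc j
    v = N C j
    pascalM = sym (nCk+nC[k+1]≡[n+1]C[k+1] M j)
    pascalN = sym (nCk+nC[k+1]≡[n+1]C[k+1] N j)
    assoc = cong (_+ suc j) (+-assoc r e (P * e))
    F₁ : closedForm (suc r) (suc P) (suc j) ≡ suc r * (y + x) * (v + u)
    F₁ = cong₂ (λ a b → suc r * a * b) pascalM pascalN
    F₂ : closedForm (r + e) P (suc j) ≡ (r + e) * x * u
    F₂ = cong (λ a → (r + e) * (a C suc j) * u) assoc
    F₃ : closedForm r (suc P) (suc j) ≡ r * x * (v + u)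
    F₃ = cong (r * x *_) pascalN
    F₄ : closedForm (suc r + e) P (suc j) ≡ (suc r + e) * (y + x) * u
    F₄ = cong (λ a → (suc r + e) * a * u) (trans (cong (λ a → suc a C suc j) assoc) pascalM)
    F₅ : closedForm (suc r) (suc P) j ≡ suc r * y * v
    F₅ = cong₂ (λ a b → suc r * (a C j) * (b C j))
               (sym (+-suc (r + suc P * e) j)) (sym (+-suc P j))
    hx : suc j * x ≡ (suc r + suc P * e) * y
    hx = subst (λ n → suc j * (n C suc j) ≡ (suc r + suc P * e) * (n C j))
               (sym (+-suc (r + suc P * e) j)) ([k+1]*[a+k]C[k+1]≡a*[a+k]Ck (suc r + suc P * e) j)
    hu : suc j * u ≡ suc P * v
    hu = subst (λ n → suc j * (n C suc j) ≡ suc P * (n C j))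
               (sym (+-suc P j)) ([k+1]*[a+k]C[k+1]≡a*[a+k]Ck (suc P) j)
    T = e * y * (suc P * v) + suc r * y * v
    LHS = suc j * (suc r * (y + x) * (v + u) + (r + e) * x * u)
    RHS = suc j * (r * x * (v + u) + (suc r + e) * (y + x) * u) + suc (suc j) * (suc r * y * v)
    expand : ∀ j r e x y u v →
      suc j * (suc r * (y + x) * (v + u) + (r + e) * x * u) + (e * y * (suc j * u) + suc r * y * v)
        ≡ suc j * (r * x * (v + u) + (suc r + e) * (y + x) * u) + suc (suc j) * (suc r * y * v)
          + suc j * x * v
    expand = solve-∀
    regroup : ∀ r e P y v → (suc r + suc P * e) * y * v ≡ e * y * (suc P * v) + suc r * y * v
    regroup = solve-∀
    -- LHS − RHS = (j + 1) x v − (j + 1) e y u − (r + 1) y v, which vanishes by hx and hu.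
    balance : LHS + T ≡ RHS + T
    balance = begin
      LHS + T                                      ≡⟨ cong (λ z → LHS + (e * y * z + suc r * y * v)) (sym hu) ⟩
      LHS + (e * y * (suc j * u) + suc r * y * v)  ≡⟨ expand j r e x y u v ⟩
      RHS + suc j * x * v                          ≡⟨ cong (λ z → RHS + z * v) hx ⟩
      RHS + (suc r + suc P * e) * y * v            ≡⟨ cong (RHS +_) (regroup r e P y v) ⟩
      RHS + T                                      ∎

  scaled-recurrence : ∀ j {a b c F G H} → a ≡ b + c →
    suc (suc j) * b ≡ G → suc j * c ≡ H → suc j * F ≡ suc j * G + suc (suc j) * H →
    suc (suc j) * a ≡ F
  scaled-recurrence j {a} {b} {c} {F} {G} {H} a≡b+c hb hc hF = *-cancelˡ-≡ _ _ (suc j) (begin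
    suc j * (suc (suc j) * a)                          ≡⟨ cong (λ z → suc j * (suc (suc j) * z)) a≡b+c ⟩
    suc j * (suc (suc j) * (b + c))                    ≡⟨ distribute j b c ⟩
    suc j * (suc (suc j) * b) + suc (suc j) * (suc j * c) ≡⟨ cong₂ (λ g h → suc j * g + suc (suc j) * h) hb hc ⟩
    suc j * G + suc (suc j) * H                        ≡⟨ sym hF ⟩
    suc j * F                                          ∎)
    where
    distribute : ∀ j b c → suc j * (suc (suc j) * (b + c))
                           ≡ suc j * (suc (suc j) * b) + suc (suc j) * (suc j * c)
    distribute = solve-∀

  rowCount′-closedForm : ∀ P k r → suc k * rowCount′ r P k ≡ closedForm r P k
  rowCount′-closedForm P       k       zero    = *-zeroʳ (suc k)
  rowCount′-closedForm P       zero    (suc r) =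
    trans (*-identityˡ _) (trans (rowCount′-single-L P (suc r)) (sym (trans (*-identityʳ _) (*-identityʳ _))))
  rowCount′-closedForm zero    (suc j) (suc r) =
    scaled-recurrence j {b = rowCount′ r 0 (suc j)} {c = rowCount′ (suc r) 0 j} recurrence
      (rowCount′-closedForm zero (suc j) r) (rowCount′-closedForm zero j (suc r)) (closedForm-recurrence₀ r j)
    where
    recurrence : rowCount′ (suc r) 0 (suc j) ≡ rowCount′ r 0 (suc j) + rowCount′ (suc r) 0 j
    recurrence = cong (λ m → rowCount′ r 0 (suc j) + (m + rowCount′ (suc r) 0 j))
                      (monoRowCount-vanishes (r + e) (n<1+n j))
  rowCount′-closedForm (suc P) (suc j) (suc r) = +-cancelʳ-≡ _ _ _ (begin
    K * a₁ + closedForm (r + e) P (suc j)  ≡⟨ cong (K * a₁ +_) (sym (rowCount′-closedForm P (suc j) (r + e))) ⟩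
    K * a₁ + K * a₂                        ≡⟨ sym (*-distribˡ-+ K a₁ a₂) ⟩
    K * (a₁ + a₂)                          ≡⟨ scaled-recurrence j {b = a₃ + a₄} {c = a₅} recurrence
                                                (scaled-sum (rowCount′-closedForm (suc P) (suc j) r)
                                                            (rowCount′-closedForm P (suc j) (suc r + e)))
                                                (rowCount′-closedForm (suc P) j (suc r)) (closedForm-recurrence r P j) ⟩
    closedForm (suc r) (suc P) (suc j) + closedForm (r + e) P (suc j) ∎)
    where
    K = suc (suc j)
    a₁ = rowCount′ (suc r) (suc P) (suc j)
    a₂ = rowCount′ (r + e) P (suc j)
    a₃ = rowCount′ r (suc P) (suc j)
    a₄ = rowCount′ (suc r + e) P (suc j)
    a₅ = rowCount′ (suc r) (suc P) j
    recurrence : a₁ + a₂ ≡ a₃ + a₄ + a₅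
    recurrence = trans (rowCount′-recurrence r P (suc j))
                       (cong (λ n → a₃ + a₄ + rowCount (suc r) (suc n) (suc j)) (+-suc P j))
    scaled-sum : ∀ {F₃ F₄} → K * a₃ ≡ F₃ → K * a₄ ≡ F₄ → K * (a₃ + a₄) ≡ F₃ + F₄
    scaled-sum h₃ h₄ = trans (*-distribˡ-+ K a₃ a₄) (cong₂ _+_ h₃ h₄)

module _ (d′ : ℕ) where
  open RowCounts (suc d′)

  monoRowCount-closedForm′ : ∀ P k → let n = P + k in
    suc n * monoRowCount 0 n k ≡ (suc n C suc k) * ((n + P * d′ + 1) C k)
  monoRowCount-closedForm′ P k = *-cancelˡ-≡ _ _ (suc k) (begin
    suc k * (suc n * N)                ≡⟨ swap (suc k) (suc n) N ⟩
    suc n * (suc k * N)                ≡⟨ cong (suc n *_) (rowCount′-closedForm P k 1) ⟩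
    suc n * (1 * W′ * (n C k))         ≡⟨ regroup n W′ (n C k) ⟩
    suc n * (n C k) * W′               ≡⟨ cong (_* W′) (sym ([k+1]*[n+1]C[k+1]≡[n+1]*nCk n k)) ⟩
    suc k * (suc n C suc k) * W′       ≡⟨ *-assoc (suc k) (suc n C suc k) W′ ⟩
    suc k * ((suc n C suc k) * W′)     ≡⟨ cong (λ i → suc k * ((suc n C suc k) * (i C k))) (reindex P k d′) ⟩
    suc k * ((suc n C suc k) * ((n + P * d′ + 1) C k)) ∎)
    where
    n = P + k
    -- rowCount′ 1 P k unfolds to N: a one-atom row containing L is L(M) for a monomial M.
    N = monoRowCount 0 n k
    W′ = (1 + P * suc d′ + k) C k
    swap : ∀ a b c → a * (b * c) ≡ b * (a * c)
    swap = solve-∀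
    regroup : ∀ n w v → suc n * (1 * w * v) ≡ suc n * v * w
    regroup = solve-∀
    reindex : ∀ P k d′ → 1 + P * suc d′ + k ≡ P + k + P * d′ + 1
    reindex = solve-∀

  monoRowCount-closedForm : ∀ n k →
    suc n * monoRowCount 0 n k ≡ (suc n C suc k) * ((n + (n ∸ k) * d′ + 1) C k)
  monoRowCount-closedForm n k with k ≤? n
  ... | yes k≤n = subst (λ m → suc m * monoRowCount 0 m k ≡ (suc m C suc k) * ((m + (n ∸ k) * d′ + 1) C k))
                        (m∸n+n≡m k≤n) (monoRowCount-closedForm′ (n ∸ k) k)
  ... | no k≰n = begin
    suc n * monoRowCount 0 n k   ≡⟨ cong (suc n *_) (monoRowCount-vanishes 0 (≰⇒> k≰n)) ⟩
    suc n * 0                    ≡⟨ *-zeroʳ (suc n) ⟩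
    0                            ≡⟨ sym (cong (_* ((n + (n ∸ k) * d′ + 1) C k)) (k>n⇒nCk≡0 (s≤s (≰⇒> k≰n)))) ⟩
    (suc n C suc k) * ((n + (n ∸ k) * d′ + 1) C k) ∎

take-++ : ∀ {A : Set} {m n} (xs : Vec A m) (ys : Vec A n) → take m (xs ++ ys) ≡ xs
take-++ []       ys = refl
take-++ (x ∷ xs) ys = cong (x ∷_) (take-++ xs ys)

drop-++ : ∀ {A : Set} {m n} (xs : Vec A m) (ys : Vec A n) → drop m (xs ++ ys) ≡ ys
drop-++ []       ys = refl
drop-++ (x ∷ xs) ys = drop-++ xs ys

fibre-≡ : ∀ {A : Set} {f g : A → ℕ} {n k} {a b : A}
            {p : f a ≡ n} {q : g a ≡ k} {p′ : f b ≡ n} {q′ : g b ≡ k} →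
          a ≡ b → _≡_ {A = Σ A λ x → f x ≡ n × g x ≡ k} (a , p , q) (b , p′ , q′)
fibre-≡ refl = cong₂ (λ p q → _ , p , q) (≡-irrelevant _ _) (≡-irrelevant _ _)

empty↔Fin0 : ∀ {A : Set} → (A → ⊥) → A ↔ Fin 0
empty↔Fin0 ¬a = mk↔ₛ′ (λ a → ⊥-elim (¬a a)) (λ ()) (λ ()) (λ a → ⊥-elim (¬a a))

module Enumeration (d : ℕ) where
  e : ℕ
  e = d ∸ 1

  open RowCounts e

  toptV-++ : ∀ {m n} (as : Vec (Atom d) m) (bs : Vec (Atom d) n) → toptV (as ++ bs) ≡ toptV as + toptV bs
  toptV-++ []       bs = refl
  toptV-++ (a ∷ as) bs = trans (cong (toptA a +_) (toptV-++ as bs)) (sym (+-assoc (toptA a) _ _))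

  loptV-++ : ∀ {m n} (as : Vec (Atom d) m) (bs : Vec (Atom d) n) → loptV (as ++ bs) ≡ loptV as + loptV bs
  loptV-++ []       bs = refl
  loptV-++ (a ∷ as) bs = trans (cong (loptA a +_) (loptV-++ as bs)) (sym (+-assoc (loptA a) _ _))

  Row : ℕ → ℕ → ℕ → Set
  Row r n k = Σ (Vec (Atom d) r) λ as → toptV as ≡ n × loptV as ≡ k

  toptMR : ∀ {r} → Mono d × Vec (Atom d) r → ℕ
  toptMR (M , as) = topt M + toptV as

  loptMR : ∀ {r} → Mono d × Vec (Atom d) r → ℕ
  loptMR (M , as) = lopt M + loptV as

  MonoRow : ℕ → ℕ → ℕ → Set
  MonoRow r n k = Σ (Mono d × Vec (Atom d) r) λ x → toptMR x ≡ n × loptMR x ≡ k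

  Row-empty : Row 0 0 0 ↔ Fin 1
  Row-empty = ↔-trans (mk↔ₛ′ _ (λ _ → [] , refl , refl) (λ _ → refl) λ { ([] , refl , refl) → refl }) (↔-sym 1↔⊤)

  Row-drop-ind : ∀ {r n k} → (∀ M (as : Vec (Atom d) r) → toptV (L M ∷ as) ≡ n → loptV (L M ∷ as) ≡ k → ⊥) →
             Row (suc r) n k ↔ Row r n k
  Row-drop-ind {r} {n} {k} no-L = mk↔ₛ′ to from (λ _ → refl) from∘to
    where
    to : Row (suc r) n k → Row r n k
    to (ind ∷ as , p , q) = as , p , q
    to (L M ∷ as , p , q) = ⊥-elim (no-L M as p q)
    from : Row r n k → Row (suc r) n k
    from (as , p , q) = ind ∷ as , p , q
    from∘to : ∀ x → from (to x) ≡ x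
    from∘to (ind ∷ as , p , q) = refl
    from∘to (L M ∷ as , p , q) = ⊥-elim (no-L M as p q)

  Row-split : ∀ r n k → Row (suc r) (suc n) (suc k) ↔ (Row r (suc n) (suc k) ⊎ MonoRow r n k)
  Row-split r n k = mk↔ₛ′ to from to∘from from∘to
    where
    to : Row (suc r) (suc n) (suc k) → Row r (suc n) (suc k) ⊎ MonoRow r n k
    to (ind ∷ as , p , q) = inj₁ (as , p , q)
    to (L M ∷ as , p , q) = inj₂ ((M , as) , suc-injective p , suc-injective q)
    from : Row r (suc n) (suc k) ⊎ MonoRow r n k → Row (suc r) (suc n) (suc k)
    from (inj₁ (as , p , q))       = ind ∷ as , p , q
    from (inj₂ ((M , as) , p , q)) = L M ∷ as , cong suc p , cong suc q
    to∘from : ∀ y → to (from y) ≡ y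
    to∘from (inj₁ _)            = refl
    to∘from (inj₂ ((M , as) , _)) = cong inj₂ (fibre-≡ refl)
    from∘to : ∀ x → from (to x) ≡ x
    from∘to (ind ∷ as , _)  = refl
    from∘to (L M ∷ as , _) = fibre-≡ refl

  MonoRow-no-ops : ∀ r k → MonoRow r 0 k ↔ Row r 0 k
  MonoRow-no-ops r k = mk↔ₛ′ to from (λ _ → refl) from∘to
    where
    to : MonoRow r 0 k → Row r 0 k
    to ((concat zero (ind ∷ []) , as) , p , q) = as , p , q
    from : Row r 0 k → MonoRow r 0 k
    from (as , p , q) = (concat zero (ind ∷ []) , as) , p , q
    from∘to : ∀ x → from (to x) ≡ x
    from∘to ((concat zero (ind ∷ []) , as) , p , q) = refl

  -- A monomial with m + 1 products, a b₁ ⋯ b_e w, followed by the row as, is sent to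
  -- the monomial a w with m products followed by the row as b₁ ⋯ b_e.
  unshift : ∀ {r} m → Atom d → Vec (Atom d) (suc m * e) → Vec (Atom d) r → Mono d × Vec (Atom d) (r + e)
  unshift m a bs as = concat m (a ∷ drop e bs) , as ++ take e bs

  shift : ∀ r m → Atom d → Vec (Atom d) (m * e) → Vec (Atom d) (r + e) → Mono d × Vec (Atom d) r
  shift r m a ws cs = concat (suc m) (a ∷ (drop r cs ++ ws)) , take r cs

  shift-unshift : ∀ {r} m a bs (as : Vec (Atom d) r) →
                  shift r m a (drop e bs) (as ++ take e bs) ≡ (concat (suc m) (a ∷ bs) , as)
  shift-unshift m a bs as =
    trans (cong₂ (λ us vs → concat (suc m) (a ∷ (us ++ drop e bs)) , vs) (drop-++ as _) (take-++ as _))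
          (cong (λ bs′ → concat (suc m) (a ∷ bs′) , as) (take++drop≡id e bs))

  unshift-shift : ∀ r m a ws (cs : Vec (Atom d) (r + e)) →
                  unshift m a (drop r cs ++ ws) (take r cs) ≡ (concat m (a ∷ ws) , cs)
  unshift-shift r m a ws cs =
    trans (cong₂ (λ vs us → concat m (a ∷ vs) , take r cs ++ us)
                 (drop-++ (drop r cs) ws) (take-++ (drop r cs) ws))
          (cong (concat m (a ∷ ws) ,_) (take++drop≡id r cs))

  toptMR-unshift : ∀ {r} m a bs (as : Vec (Atom d) r) →
                   toptMR (concat (suc m) (a ∷ bs) , as) ≡ suc (toptMR (unshift m a bs as))
  toptMR-unshift m a bs as = begin
    suc m + (toptA a + toptV bs) + toptV as
      ≡⟨ cong (λ bs′ → suc m + (toptA a + toptV bs′) + toptV as) (sym (take++drop≡id e bs)) ⟩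
    suc m + (toptA a + toptV (us ++ ws)) + toptV as
      ≡⟨ cong (λ t → suc m + (toptA a + t) + toptV as) (toptV-++ us ws) ⟩
    suc m + (toptA a + (toptV us + toptV ws)) + toptV as
      ≡⟨ regroup m (toptA a) (toptV us) (toptV ws) (toptV as) ⟩
    suc (m + (toptA a + toptV ws) + (toptV as + toptV us))
      ≡⟨ cong (λ t → suc (m + (toptA a + toptV ws) + t)) (sym (toptV-++ as us)) ⟩
    suc (m + (toptA a + toptV ws) + toptV (as ++ us)) ∎
    where
    us = take e bs
    ws = drop e bs
    regroup : ∀ m a u w s → suc m + (a + (u + w)) + s ≡ suc (m + (a + w) + (s + u))
    regroup = solve-∀

  loptMR-unshift : ∀ {r} m a bs (as : Vec (Atom d) r) →
                   loptMR (concat (suc m) (a ∷ bs) , as) ≡ loptMR (unshift m a bs as)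
  loptMR-unshift m a bs as = begin
    (loptA a + loptV bs) + loptV as
      ≡⟨ cong (λ bs′ → loptA a + loptV bs′ + loptV as) (sym (take++drop≡id e bs)) ⟩
    loptA a + loptV (us ++ ws) + loptV as
      ≡⟨ cong (λ t → loptA a + t + loptV as) (loptV-++ us ws) ⟩
    loptA a + (loptV us + loptV ws) + loptV as
      ≡⟨ regroup (loptA a) (loptV us) (loptV ws) (loptV as) ⟩
    loptA a + loptV ws + (loptV as + loptV us)
      ≡⟨ cong (loptA a + loptV ws +_) (sym (loptV-++ as us)) ⟩
    loptA a + loptV ws + loptV (as ++ us) ∎
    where
    us = take e bs
    ws = drop e bs
    regroup : ∀ a u w s → a + (u + w) + s ≡ a + w + (s + u)
    regroup = solve-∀

  MonoRow-split : ∀ r n k → MonoRow r (suc n) k ↔ (MonoRow (r + e) n k ⊎ Row (suc r) (suc n) k)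
  MonoRow-split r n k = mk↔ₛ′ to from to∘from from∘to
    where
    to : MonoRow r (suc n) k → MonoRow (r + e) n k ⊎ Row (suc r) (suc n) k
    to ((concat zero (a ∷ []) , as) , p , q) =
      inj₂ (a ∷ as , trans (cong (_+ toptV as) (sym (+-identityʳ (toptA a)))) p
                   , trans (cong (_+ loptV as) (sym (+-identityʳ (loptA a)))) q)
    to ((concat (suc m) (a ∷ bs) , as) , p , q) =
      inj₁ (unshift m a bs as , suc-injective (trans (sym (toptMR-unshift m a bs as)) p)
                              , trans (sym (loptMR-unshift m a bs as)) q)
    from : MonoRow (r + e) n k ⊎ Row (suc r) (suc n) k → MonoRow r (suc n) k
    from (inj₁ ((concat m (a ∷ ws) , cs) , p , q)) =
      shift r m a ws cs
        , trans (toptMR-unshift m a _ (take r cs)) (cong suc (trans (cong toptMR (unshift-shift r m a ws cs)) p))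
        , trans (loptMR-unshift m a _ (take r cs)) (trans (cong loptMR (unshift-shift r m a ws cs)) q)
    from (inj₂ (a ∷ as , p , q)) =
      (concat zero (a ∷ []) , as) , trans (cong (_+ toptV as) (+-identityʳ (toptA a))) p
                                  , trans (cong (_+ loptV as) (+-identityʳ (loptA a))) q
    to∘from : ∀ y → to (from y) ≡ y
    to∘from (inj₁ ((concat m (a ∷ ws) , cs) , _)) = cong inj₁ (fibre-≡ (unshift-shift r m a ws cs))
    to∘from (inj₂ (a ∷ as , _))                    = cong inj₂ (fibre-≡ refl)
    from∘to : ∀ x → from (to x) ≡ x
    from∘to ((concat zero    (a ∷ [])  , as) , _) = fibre-≡ refl
    from∘to ((concat (suc m) (a ∷ bs) , as) , _) = fibre-≡ (shift-unshift m a bs as)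

  mutual
    Row↔Fin : ∀ r n k → Row r n k ↔ Fin (rowCount r n k)
    Row↔Fin zero    zero    zero    = Row-empty
    Row↔Fin zero    (suc n) k       = empty↔Fin0 λ { ([] , () , _) }
    Row↔Fin zero    zero    (suc k) = empty↔Fin0 λ { ([] , _ , ()) }
    Row↔Fin (suc r) n       zero    = ↔-trans (Row-drop-ind λ { _ _ _ () }) (Row↔Fin r n zero)
    Row↔Fin (suc r) zero    (suc k) = ↔-trans (Row-drop-ind λ { _ _ () _ }) (Row↔Fin r zero (suc k))
    Row↔Fin (suc r) (suc n) (suc k) =
      ↔-trans (Row-split r n k) (↔-trans (Row↔Fin r (suc n) (suc k) ⊎-↔ MonoRow↔Fin r n k) (↔-sym +↔⊎))

    MonoRow↔Fin : ∀ r n k → MonoRow r n k ↔ Fin (monoRowCount r n k)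
    MonoRow↔Fin r zero    k = ↔-trans (MonoRow-no-ops r k) (Row↔Fin r zero k)
    MonoRow↔Fin r (suc n) k =
      ↔-trans (MonoRow-split r n k) (↔-trans (MonoRow↔Fin (r + e) n k ⊎-↔ Row↔Fin (suc r) (suc n) k) (↔-sym +↔⊎))

  Mono↔MonoRow : ∀ n k → (Σ (Mono d) λ M → topt M ≡ n × lopt M ≡ k) ↔ MonoRow 0 n k
  Mono↔MonoRow n k = mk↔ₛ′ to from (λ { ((M , []) , _) → fibre-≡ refl }) (λ _ → fibre-≡ refl)
    where
    to : (Σ (Mono d) λ M → topt M ≡ n × lopt M ≡ k) → MonoRow 0 n k
    to (M , p , q) = (M , []) , trans (+-identityʳ (topt M)) p , trans (+-identityʳ (lopt M)) q
    from : MonoRow 0 n k → Σ (Mono d) λ M → topt M ≡ n × lopt M ≡ k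
    from ((M , []) , p , q) = M , trans (sym (+-identityʳ (topt M))) p , trans (sym (+-identityʳ (lopt M))) q

theorem2p1 : (d n k : ℕ) → 2 ≤ d →
    ∃ λ (N : ℕ) →
      ((Σ (Mono d) λ M → topt M ≡ n × lopt M ≡ k) ↔ Fin N)
      × (suc n * N ≡ (suc n C suc k) * ((n + (n ∸ k) * (d ∸ 2) + 1) C k))
theorem2p1 (suc (suc d′)) n k (s≤s (s≤s z≤n)) =
  monoRowCount 0 n k , ↔-trans (Mono↔MonoRow n k) (MonoRow↔Fin 0 n k) , monoRowCount-closedForm d′ n k
  where
  open RowCounts (suc d′)
  open Enumeration (suc (suc d′))
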